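{- For every integer $k\ge 2$, the Odd graph $O_k$ and the doubled Odd graph $D(O_k)$ have equal metric dimension, and this metric dimension is at most $2k-2$.
   Context: The Odd graph $O_k$ has as vertices all $(k-1)$-subsets of a fixed $(2k-1)$-set, two vertices adjacent iff the subsets are disjoint. The doubled Odd graph $D(O_k)$ is its bipartite double: vertex set two disjoint copies $V^+,V^-$ of the vertex set of $O_k$, with $u^+$ adjacent to $w^-$ iff $u,w$ are adjacent in $O_k$, and no other edges. The metric dimension of a connected graph is the minimum size of a vertex set $R$ such that any two distinct vertices $x,y$ have some $w\in R$ with $\d(x,w)\ne\d(y,w)$, with $\d$ the path distance. -}

module Defs where

open import Level using (0ℓ)
open import Data.Nat using (ℕ; zero; suc; _≤_; _∸_; _*_)
open import Data.Bool using (Bool)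
open import Data.Product using (Σ; ∃; _×_; _,_)
open import Data.Empty using (⊥)
open import Data.List using (List; length)
open import Data.List.Membership.Propositional using (_∈_)
open import Data.Fin.Subset as S using (Subset; ∣_∣)
open import Relation.Binary.PropositionalEquality using (_≡_; _≢_)

record Graph : Set₁ where
  field
    V : Set
    E : V → V → Set
open Graph public

data Walk (G : Graph) : V G → V G → ℕ → Set where
  nil  : ∀ {x} → Walk G x x 0
  cons : ∀ {x y z n} → E G x y → Walk G y z n → Walk G x z (suc n)

Dist : (G : Graph) → V G → V G → ℕ → Set
Dist G x y n = Walk G x y n × (∀ m → Walk G x y m → n ≤ m)

Distinguishes : (G : Graph) → V G → V G → V G → Set
Distinguishes G w x y = ∀ m n → Dist G x w m → Dist G y w n → m ≢ n

Resolving : (G : Graph) → List (V G) → Set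
Resolving G R = ∀ x y → x ≢ y → ∃ λ w → w ∈ R × Distinguishes G w x y

-- The metric dimension of G equals d: there is a resolving set of size d,
-- and every resolving set has size ≥ d.  (Minimum over lists equals minimum
-- over duplicate-free lists, i.e. over finite vertex sets.)
MetricDimension : (G : Graph) → ℕ → Set
MetricDimension G d =
  (∃ λ R → length R ≡ d × Resolving G R) ×
  (∀ R → Resolving G R → d ≤ length R)

OddVertex : ℕ → Set
OddVertex k = Σ (Subset (2 * k ∸ 1)) (λ s → ∣ s ∣ ≡ k ∸ 1)

Disjoint : ∀ {n} → Subset n → Subset n → Set
Disjoint s t = ∀ i → i S.∈ s → i S.∈ t → ⊥

Odd : ℕ → Graph
Odd k = record
  { V = OddVertex k
  ; E = λ u w → Disjoint (Data.Product.proj₁ u) (Data.Product.proj₁ w) }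

BipartiteDouble : Graph → Graph
BipartiteDouble G = record
  { V = Bool × V G
  ; E = λ { (b , u) (c , w) → b ≢ c × E G u w } }

DoubledOdd : ℕ → Graph
DoubledOdd k = BipartiteDouble (Odd k)

-- Write m = k - 1, so that O_k is the graph on the m-subsets of a (2m + 1)-set. If v is adjacent to u,
-- then |v ∩ w| is m - |u ∩ w| or m - 1 - |u ∩ w|; it follows that there is a walk of length 2h from u
-- to w iff |u ∩ w| ≥ m - h, and one of length 2h + 1 iff |u ∩ w| ≤ h. So the least length of a walk of
-- a given parity determines |u ∩ w|, and conversely. In O_k the least length overall is the distance;
-- in D(O_k) the distance from (b, u) to (c, w) is the least length of the parity fixed by b and c, and
-- two vertices on opposite sides are told apart by every vertex, by parity. Hence a list of vertices
-- resolves O_k iff it separates vertices by intersection sizes, iff (put on one side) it resolves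
-- D(O_k); both metric dimensions are the least length of a separating list, which exists because
-- separation is decidable. Finally, for an m-set A, the list of A and 2m - 1 sets obtained from A by
-- exchanging one point separates: comparing |x ∩ A| with |x ∩ A′| for an exchange A′ of a for b gives
-- the balance x(b) - x(a) = y(b) - y(a), and these balances force x = y.

module Submission where

open import Defs
open import Data.Bool using (Bool; true; false; _∧_; not; if_then_else_) renaming (_≟_ to _≟ᵇ_)
open import Data.Bool.Properties using (∧-identityʳ; ∧-zeroʳ; ∧-idem; not-involutive; not-injective; ¬-not; not-¬)
open import Data.Empty using (⊥; ⊥-elim)
open import Data.Fin using (Fin; zero; suc; _↑ˡ_; _↑ʳ_; splitAt)
open import Data.Fin.Properties using (splitAt⁻¹-↑ˡ; splitAt⁻¹-↑ʳ)
open import Data.Fin.Subset using (Subset; ∣_∣)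
open import Data.Fin.Subset.Properties using (anySubset?)
open import Data.List using (List; []; _∷_; length; map)
import Data.List as List
open import Data.List.Membership.Propositional using (_∈_; find; lose)
open import Data.List.Membership.Propositional.Properties using (∈-map⁺; ∈-map⁻; ∈-++⁺ˡ; ∈-++⁺ʳ; ∈-tabulate⁺)
open import Data.List.Properties using (length-map; map-∘; map-id; length-++; length-tabulate)
open import Data.List.Relation.Unary.Any using (any?; here; there)
open import Data.Nat using (ℕ; zero; suc; _+_; _*_; _∸_; _≤_; _<_; z≤n; s≤s; s≤s⁻¹; _≤?_; _<?_)
open import Data.Nat.Properties hiding (≡ᵇ⇒≡)
open import Algebra.Properties.CommutativeMonoid.Sum +-0-commutativeMonoid using (sum; sum-cong-≗; ∑-distrib-+)
open import Data.Product using (Σ; ∃; _×_; _,_; proj₁; proj₂)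
open import Data.Sum using (_⊎_; inj₁; inj₂)
open import Data.Vec using ([]; _∷_; lookup; tabulate)
open import Data.Vec.Properties using (≡-dec; lookup∘tabulate; tabulate∘lookup; tabulate-cong; []=⇒lookup; lookup⇒[]=)
open import Data.Vec.Functional using (replicate) renaming (_∷_ to _∷ᶠ_; _++_ to _++ᶠ_)
open import Data.Vec.Functional.Properties using (lookup-++ˡ; lookup-++ʳ)
open import Function using (_∘_; case_of_)
open import Relation.Binary.PropositionalEquality
open import Relation.Nullary using (¬_; Dec; yes; no)
open import Relation.Nullary.Decidable using (map′; ¬?; decidable-stable; _→-dec_)

-- Sums of indicators

𝟙 : Bool → ℕ
𝟙 true  = 1
𝟙 false = 0

𝟙-injective : ∀ {a b} → 𝟙 a ≡ 𝟙 b → a ≡ b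
𝟙-injective {true}  {true}  _ = refl
𝟙-injective {false} {false} _ = refl

𝟙-∧-≤ˡ : ∀ a b → 𝟙 (a ∧ b) ≤ 𝟙 a
𝟙-∧-≤ˡ true  true  = ≤-refl
𝟙-∧-≤ˡ true  false = z≤n
𝟙-∧-≤ˡ false _     = z≤n

𝟙-∧-≤ʳ : ∀ a b → 𝟙 (a ∧ b) ≤ 𝟙 b
𝟙-∧-≤ʳ true  _ = ≤-refl
𝟙-∧-≤ʳ false _ = z≤n

𝟙-not∧not-positive : ∀ a b → 0 < 𝟙 (not a ∧ not b) → a ≡ false × b ≡ false
𝟙-not∧not-positive false false _ = refl , refl

𝟙-not∧-positive : ∀ a b → 0 < 𝟙 (not a ∧ b) → a ≡ false × b ≡ true
𝟙-not∧-positive false true _ = refl , refl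

sum-mono-≤ : ∀ {n} {f g : Fin n → ℕ} → (∀ i → f i ≤ g i) → sum f ≤ sum g
sum-mono-≤ {zero}  f≤g = z≤n
sum-mono-≤ {suc n} f≤g = +-mono-≤ (f≤g zero) (sum-mono-≤ (f≤g ∘ suc))

sum-const : ∀ n c → sum {n} (λ _ → c) ≡ n * c
sum-const zero    c = refl
sum-const (suc n) c = cong (c +_) (sum-const n c)

sum-one : ∀ n → sum {n} (λ _ → 1) ≡ n
sum-one n = trans (sum-const n 1) (*-identityʳ n)

sum-zero : ∀ n → sum {n} (λ _ → 0) ≡ 0
sum-zero n = trans (sum-const n 0) (*-zeroʳ n)

sum-mono-≤-tight : ∀ {n} {f g : Fin n → ℕ} → (∀ i → f i ≤ g i) → sum g ≤ sum f → ∀ i → f i ≡ g i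
sum-mono-≤-tight {suc n} {f} {g} f≤g ∑g≤∑f = tight
  where
  head≡ : f zero ≡ g zero
  tail≤ : sum (g ∘ suc) ≤ sum (f ∘ suc)
  head≡ = ≤-antisym (f≤g zero) (+-cancelʳ-≤ _ _ _ (≤-trans ∑g≤∑f (+-monoʳ-≤ (f zero) (sum-mono-≤ (f≤g ∘ suc)))))
  tail≤ = +-cancelˡ-≤ (g zero) _ _ (subst (λ z → _ ≤ z + _) head≡ ∑g≤∑f)
  tight : ∀ i → f i ≡ g i
  tight zero    = head≡
  tight (suc i) = sum-mono-≤-tight (f≤g ∘ suc) tail≤ i

sum-positive : ∀ {n} (f : Fin n → ℕ) → 0 < sum f → ∃ λ i → 0 < f i
sum-positive {suc n} f 0<∑ with f zero in eq
... | suc _ = zero , subst (0 <_) (sym eq) (s≤s z≤n)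
... | zero with sum-positive (f ∘ suc) 0<∑
...   | i , 0<fi = suc i , 0<fi

_≡ᵇ_ : ∀ {n} → Fin n → Fin n → Bool
zero  ≡ᵇ zero  = true
zero  ≡ᵇ suc _ = false
suc _ ≡ᵇ zero  = false
suc i ≡ᵇ suc j = i ≡ᵇ j

≡ᵇ⇒≡ : ∀ {n} (i j : Fin n) → i ≡ᵇ j ≡ true → i ≡ j
≡ᵇ⇒≡ zero    zero    _ = refl
≡ᵇ⇒≡ (suc i) (suc j) e = cong suc (≡ᵇ⇒≡ i j e)

sum-select : ∀ {n} (x : Fin n → Bool) (i : Fin n) → sum (λ j → 𝟙 (x j ∧ j ≡ᵇ i)) ≡ 𝟙 (x i)
sum-select {suc n} x zero = begin
  𝟙 (x zero ∧ true) + sum (λ j → 𝟙 (x (suc j) ∧ false))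
    ≡⟨ cong₂ _+_ (cong 𝟙 (∧-identityʳ (x zero))) (sum-cong-≗ (cong 𝟙 ∘ ∧-zeroʳ ∘ x ∘ suc)) ⟩
  𝟙 (x zero) + sum {n} (λ _ → 0)
    ≡⟨ cong (𝟙 (x zero) +_) (sum-zero n) ⟩
  𝟙 (x zero) + 0
    ≡⟨ +-identityʳ _ ⟩
  𝟙 (x zero) ∎
  where open ≡-Reasoning
sum-select {suc n} x (suc i) =
  trans (cong (_+ sum {n} (λ j → 𝟙 (x (suc j) ∧ j ≡ᵇ i))) (cong 𝟙 (∧-zeroʳ (x zero)))) (sum-select (x ∘ suc) i)

sum-↑ : ∀ a b (g : Fin (a + b) → ℕ) → sum g ≡ sum (g ∘ (_↑ˡ b)) + sum (g ∘ (a ↑ʳ_))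
sum-↑ zero    b g = refl
sum-↑ (suc a) b g = trans (cong (g zero +_) (sum-↑ a b (g ∘ suc))) (sym (+-assoc (g zero) _ _))

↑-view : ∀ a {b} (j : Fin (a + b)) → (∃ λ i → j ≡ i ↑ˡ b) ⊎ (∃ λ i → j ≡ a ↑ʳ i)
↑-view a j with splitAt a j in eq
... | inj₁ i = inj₁ (i , sym (splitAt⁻¹-↑ˡ eq))
... | inj₂ i = inj₂ (i , sym (splitAt⁻¹-↑ʳ eq))

common : ∀ {n} → (Fin n → Bool) → (Fin n → Bool) → ℕ
common x f = sum (λ j → 𝟙 (x j ∧ f j))

swap : ∀ {n} → (Fin n → Bool) → Fin n → Fin n → Fin n → Bool
swap f l t j = if j ≡ᵇ t then true else if j ≡ᵇ l then false else f j

common-swap : ∀ {n} (f : Fin n → Bool) {l t} → f l ≡ true → f t ≡ false → ∀ x →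
               common x (swap f l t) + 𝟙 (x l) ≡ common x f + 𝟙 (x t)
common-swap f {l} {t} l∈f t∉f x = begin
  common x (swap f l t) + 𝟙 (x l)
    ≡⟨ cong (common x (swap f l t) +_) (sym (sum-select x l)) ⟩
  common x (swap f l t) + sum (λ j → 𝟙 (x j ∧ j ≡ᵇ l))
    ≡⟨ sym (∑-distrib-+ (λ j → 𝟙 (x j ∧ swap f l t j)) (λ j → 𝟙 (x j ∧ j ≡ᵇ l))) ⟩
  sum (λ j → 𝟙 (x j ∧ swap f l t j) + 𝟙 (x j ∧ j ≡ᵇ l))
    ≡⟨ sum-cong-≗ (λ j → pointwise (x j) (j ≡ᵇ t) (j ≡ᵇ l) (f j) (at t∉f j) (at l∈f j)) ⟩
  sum (λ j → 𝟙 (x j ∧ f j) + 𝟙 (x j ∧ j ≡ᵇ t))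
    ≡⟨ ∑-distrib-+ (λ j → 𝟙 (x j ∧ f j)) (λ j → 𝟙 (x j ∧ j ≡ᵇ t)) ⟩
  common x f + sum (λ j → 𝟙 (x j ∧ j ≡ᵇ t))
    ≡⟨ cong (common x f +_) (sum-select x t) ⟩
  common x f + 𝟙 (x t) ∎
  where
  open ≡-Reasoning
  at : ∀ {i b} → f i ≡ b → ∀ j → j ≡ᵇ i ≡ true → f j ≡ b
  at {i} fi≡b j j≡ᵇi = trans (cong f (≡ᵇ⇒≡ j i j≡ᵇi)) fi≡b
  pointwise : ∀ a e₁ e₂ c → (e₁ ≡ true → c ≡ false) → (e₂ ≡ true → c ≡ true) →
              𝟙 (a ∧ (if e₁ then true else if e₂ then false else c)) + 𝟙 (a ∧ e₂) ≡ 𝟙 (a ∧ c) + 𝟙 (a ∧ e₁)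
  pointwise a     true  true  c     c≡false c≡true with () ← trans (sym (c≡false refl)) (c≡true refl)
  pointwise true  true  false c     c≡false _ rewrite c≡false refl = refl
  pointwise false true  false c     _       _ = refl
  pointwise true  false true  c     _ c≡true rewrite c≡true refl = refl
  pointwise false false true  c     _       _ = refl
  pointwise a     false false c     _       _ = refl

swap-size : ∀ {n} (f : Fin n → Bool) {l t} → f l ≡ true → f t ≡ false → sum (𝟙 ∘ swap f l t) ≡ sum (𝟙 ∘ f)
swap-size f l∈f t∉f = +-cancelʳ-≡ 1 _ _ (common-swap f l∈f t∉f (λ _ → true))

swap-balance : ∀ {n} (f : Fin n → Bool) {l t} → f l ≡ true → f t ≡ false → ∀ x y →
               common x f ≡ common y f → common x (swap f l t) ≡ common y (swap f l t) →
               𝟙 (x t) + 𝟙 (y l) ≡ 𝟙 (y t) + 𝟙 (x l)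
swap-balance f {l} {t} l∈f t∉f x y same-f same-swap = +-cancelˡ-≡ (common x f) _ _ (begin
  common x f + (𝟙 (x t) + 𝟙 (y l))          ≡⟨ sym (+-assoc (common x f) _ _) ⟩
  (common x f + 𝟙 (x t)) + 𝟙 (y l)          ≡⟨ cong (_+ 𝟙 (y l)) (sym (common-swap f l∈f t∉f x)) ⟩
  (common x (swap f l t) + 𝟙 (x l)) + 𝟙 (y l) ≡⟨ +-assoc (common x (swap f l t)) _ _ ⟩
  common x (swap f l t) + (𝟙 (x l) + 𝟙 (y l)) ≡⟨ cong₂ _+_ same-swap (+-comm (𝟙 (x l)) (𝟙 (y l))) ⟩
  common y (swap f l t) + (𝟙 (y l) + 𝟙 (x l)) ≡⟨ sym (+-assoc (common y (swap f l t)) _ _) ⟩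
  (common y (swap f l t) + 𝟙 (y l)) + 𝟙 (x l) ≡⟨ cong (_+ 𝟙 (x l)) (common-swap f l∈f t∉f y) ⟩
  (common y f + 𝟙 (y t)) + 𝟙 (x l)          ≡⟨ cong (λ s → (s + 𝟙 (y t)) + 𝟙 (x l)) (sym same-f) ⟩
  (common x f + 𝟙 (y t)) + 𝟙 (x l)          ≡⟨ +-assoc (common x f) _ _ ⟩
  common x f + (𝟙 (y t) + 𝟙 (x l))          ∎)
  where open ≡-Reasoning

-- Least elements and exhaustive search

Least : (ℕ → Set) → Set
Least P = ∃ λ d → P d × (∀ d′ → P d′ → d ≤ d′)

least : (P : ℕ → Set) → (∀ d → Dec (P d)) → ∀ d₀ → P d₀ → Least P
least P P? d₀ Pd₀ with search (suc d₀)
  where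
  search : ∀ k → Least P ⊎ (∀ d → d < k → ¬ P d)
  search zero = inj₂ (λ _ ())
  search (suc k) with search k
  ... | inj₁ found = inj₁ found
  ... | inj₂ below-k with P? k
  ...   | yes Pk = inj₁ (k , Pk , λ d Pd → ≮⇒≥ (λ d<k → below-k d d<k Pd))
  ...   | no ¬Pk = inj₂ below-suc-k
    where
    below-suc-k : ∀ d → d < suc k → ¬ P d
    below-suc-k d d<1+k with m≤n⇒m<n∨m≡n (s≤s⁻¹ d<1+k)
    ... | inj₁ d<k  = below-k d d<k
    ... | inj₂ refl = ¬Pk
... | inj₁ found    = found
... | inj₂ below-d₀ = ⊥-elim (below-d₀ d₀ ≤-refl Pd₀)

Searchable : Set → Set₁
Searchable A = ∀ {P : A → Set} → (∀ x → Dec (P x)) → Dec (∃ P)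

Σ-searchable : ∀ {A : Set} {B : A → Set} → Searchable A → (∀ a → Dec (B a)) → (∀ {a} (p q : B a) → p ≡ q) →
               Searchable (Σ A B)
Σ-searchable {A} search B? B-irrelevant {P} P? = map′ to from (search Q?)
  where
  Q : A → Set
  Q a = ∃ λ b → P (a , b)
  Q? : ∀ a → Dec (Q a)
  Q? a with B? a
  ... | yes b = map′ (b ,_) (λ { (b′ , Pab′) → subst (λ z → P (a , z)) (B-irrelevant b′ b) Pab′ }) (P? (a , b))
  ... | no ¬b = no (¬b ∘ proj₁)
  to : ∃ Q → ∃ P
  to (a , b , p) = (a , b) , p
  from : ∃ P → ∃ Q
  from ((a , b) , p) = a , b , p

searchable⇒all? : ∀ {A : Set} {P : A → Set} → Searchable A → (∀ x → Dec (P x)) → Dec (∀ x → P x)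
searchable⇒all? search P? =
  map′ (λ ¬∃¬P x → decidable-stable (P? x) (λ ¬Px → ¬∃¬P (x , ¬Px))) (λ ∀P (x , ¬Px) → ¬Px (∀P x)) (¬? (search (¬? ∘ P?)))

∃-list-of-length? : ∀ {A : Set} {P : List A → Set} → Searchable A → (∀ R → Dec (P R)) → ∀ d →
                    Dec (∃ λ R → length R ≡ d × P R)
∃-list-of-length? search P? zero    = map′ (λ p → [] , refl , p) (λ { ([] , _ , p) → p }) (P? [])
∃-list-of-length? {P = P} search P? (suc d) = map′ to from (search (λ x → ∃-list-of-length? search (P? ∘ (x ∷_)) d))
  where
  to : (∃ λ x → ∃ λ R → length R ≡ d × P (x ∷ R)) → ∃ λ R → length R ≡ suc d × P R
  to (x , R , len , p) = x ∷ R , cong suc len , p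
  from : (∃ λ R → length R ≡ suc d × P R) → ∃ λ x → ∃ λ R → length R ≡ d × P (x ∷ R)
  from (x ∷ R , len , p) = x , R , suc-injective len , p

least-length : ∀ {A : Set} {P : List A → Set} → Searchable A → (∀ R → Dec (P R)) → ∀ R₀ → P R₀ →
               ∃ λ d → (∃ λ R → length R ≡ d × P R) × (∀ R → P R → d ≤ length R) × d ≤ length R₀
least-length {P = P} search P? R₀ PR₀
  with d , witness , minimal ← least (λ d → ∃ λ R → length R ≡ d × P R) (∃-list-of-length? search P?) _ (R₀ , refl , PR₀)
  = d , witness , (λ R PR → minimal (length R) (R , refl , PR)) , minimal _ (R₀ , refl , PR₀)

∃-Dist : ∀ (G : Graph) {x y} → (∀ ℓ → Dec (Walk G x y ℓ)) → ∀ {ℓ} → Walk G x y ℓ → ∃ (Dist G x y)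
∃-Dist G walk? p = least _ walk? _ p

Dist-transfer : ∀ (G : Graph) {x y w a} → (∀ ℓ → Walk G x w ℓ → Walk G y w ℓ) → (∀ ℓ → Walk G y w ℓ → Walk G x w ℓ) →
                Dist G x w a → Dist G y w a
Dist-transfer G x⇒y y⇒x (p , shortest) = x⇒y _ p , λ ℓ q → shortest ℓ (y⇒x ℓ q)

-- Minimality among walks of one parity: what a distance in G and one in its bipartite double have in common.
ParityDist : (G : Graph) → V G → V G → ℕ → Set
ParityDist G x y a = Walk G x y a × (∀ ℓ → Walk G x y ℓ → suc (suc ℓ) ≢ a)

Dist⇒ParityDist : ∀ (G : Graph) {x y a} → Dist G x y a → ParityDist G x y a
Dist⇒ParityDist G (p , shortest) = p , λ { ℓ q refl → 1+n≰n (≤-trans (n≤1+n _) (shortest ℓ q)) }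

-- Bipartite doubles

flips : ℕ → Bool → Bool
flips zero    b = b
flips (suc ℓ) b = flips ℓ (not b)

flips-not : ∀ ℓ b → flips ℓ (not b) ≡ not (flips ℓ b)
flips-not zero    b = refl
flips-not (suc ℓ) b = flips-not ℓ (not b)

flips-injective : ∀ ℓ {b c} → flips ℓ b ≡ flips ℓ c → b ≡ c
flips-injective zero    b≡c = b≡c
flips-injective (suc ℓ) e   = not-injective (flips-injective ℓ e)

module _ {H : Graph} where

  private
    D : Graph
    D = BipartiteDouble H

  walk-project : ∀ {ℓ b x c y} → Walk D (b , x) (c , y) ℓ → Walk H x y ℓ × c ≡ flips ℓ b
  walk-project nil = nil , refl
  walk-project {suc ℓ} (cons {y = _ , _} (b≢c′ , x~z) p) with walk-project p
  ... | q , c≡flips = cons x~z q , trans c≡flips (cong (flips ℓ) (¬-not (b≢c′ ∘ sym)))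

  walk-lift : ∀ {ℓ x y} → Walk H x y ℓ → ∀ b → Walk D (b , x) (flips ℓ b , y) ℓ
  walk-lift nil        b = nil
  walk-lift (cons e p) b = cons (not-¬ refl , e) (walk-lift p (not b))

  walk-lift-to : ∀ {ℓ x y b c} → c ≡ flips ℓ b → Walk H x y ℓ → Walk D (b , x) (c , y) ℓ
  walk-lift-to {b = b} refl p = walk-lift p b

  walk?-double : ∀ {x y} → (∀ ℓ → Dec (Walk H x y ℓ)) → ∀ b c ℓ → Dec (Walk D (b , x) (c , y) ℓ)
  walk?-double walk? b c ℓ with walk? ℓ | c ≟ᵇ flips ℓ b
  ... | yes p | yes c≡flips = yes (walk-lift-to c≡flips p)
  ... | yes _ | no  c≢flips = no (c≢flips ∘ proj₂ ∘ walk-project)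
  ... | no ¬p | _           = no (¬p ∘ proj₁ ∘ walk-project)

  walk-transfer-double : ∀ {x y w} → (∀ ℓ → Walk H x w ℓ → Walk H y w ℓ) →
                         ∀ {b c} ℓ → Walk D (b , x) (c , w) ℓ → Walk D (b , y) (c , w) ℓ
  walk-transfer-double x⇒y ℓ p with q , c≡flips ← walk-project p = walk-lift-to c≡flips (x⇒y ℓ q)

  ∃-Dist-double : ∀ {x y ℓ} → (∀ ℓ → Dec (Walk H x y ℓ)) → Walk H x y ℓ → Walk H x y (suc ℓ) →
                  ∀ b c → ∃ (Dist D (b , x) (c , y))
  ∃-Dist-double {ℓ = ℓ} walk? p q b c with c ≟ᵇ flips ℓ b
  ... | yes c≡flips = ∃-Dist D (walk?-double walk? b c) (walk-lift-to c≡flips p)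
  ... | no  c≢flips = ∃-Dist D (walk?-double walk? b c)
                        (walk-lift-to (trans (¬-not c≢flips) (sym (flips-not ℓ b))) q)

  Dist⇒ParityDist-double : ∀ {b x c y a} → Dist D (b , x) (c , y) a → ParityDist H x y a
  Dist⇒ParityDist-double {b} {c = c} dist with p , unshortenable ← Dist⇒ParityDist D dist =
    proj₁ (walk-project p) , λ { ℓ q refl → unshortenable ℓ (walk-lift-to (flips-2 {ℓ} (proj₂ (walk-project p))) q) refl }
    where
    flips-2 : ∀ {ℓ} → c ≡ flips (suc (suc ℓ)) b → c ≡ flips ℓ b
    flips-2 {ℓ} c≡flips = trans c≡flips (cong (flips ℓ) (not-involutive b))

  opposite-sides-distinguished : ∀ {b c} x y w → b ≢ c → Distinguishes D w (b , x) (c , y)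
  opposite-sides-distinguished x y w b≢c a _ (p , _) (q , _) refl =
    b≢c (flips-injective a (trans (sym (proj₂ (walk-project p))) (proj₂ (walk-project q))))

-- Kneser graphs and the Odd graph

card-sum : ∀ {n} (s : Subset n) → ∣ s ∣ ≡ sum (𝟙 ∘ lookup s)
card-sum []          = refl
card-sum (true  ∷ s) = cong suc (card-sum s)
card-sum (false ∷ s) = card-sum s

Disjoint⇒∧≡false : ∀ {n} {s t : Subset n} → Disjoint s t → ∀ i → lookup s i ∧ lookup t i ≡ false
Disjoint⇒∧≡false {s = s} {t} s∩t=∅ i with lookup s i in si | lookup t i in ti
... | true  | true  = ⊥-elim (s∩t=∅ i (lookup⇒[]= i s si) (lookup⇒[]= i t ti))
... | true  | false = refl
... | false | _     = refl

∧≡false⇒Disjoint : ∀ {n} {s t : Subset n} → (∀ i → lookup s i ∧ lookup t i ≡ false) → Disjoint s t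
∧≡false⇒Disjoint {s = s} {t} s∧t=false i i∈s i∈t
  with s∧t=false i
... | s∧t=false-i rewrite []=⇒lookup i∈s | []=⇒lookup i∈t = case s∧t=false-i of λ ()

-- Odd k is definitionally Kneser (2k - 1) (k - 1).
Kneser : ℕ → ℕ → Graph
Kneser n m = record
  { V = Σ (Subset n) (λ s → ∣ s ∣ ≡ m)
  ; E = λ u w → Disjoint (proj₁ u) (proj₁ w)
  }

data Half : ℕ → Set where
  even : ∀ h → Half (h + h)
  odd  : ∀ h → Half (suc (h + h))

half : ∀ ℓ → Half ℓ
half zero = even zero
half (suc ℓ) with half ℓ
... | even h = odd h
... | odd h  = subst Half (cong suc (+-suc h h)) (even (suc h))

module OddGraph (m : ℕ) where

  n : ℕ
  n = suc (m + m)

  G : Graph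
  G = Kneser n m

  Vertex : Set
  Vertex = V G

  χ : Vertex → Fin n → Bool
  χ u = lookup (proj₁ u)

  χ-size : ∀ u → sum (𝟙 ∘ χ u) ≡ m
  χ-size u = trans (sym (card-sum (proj₁ u))) (proj₂ u)

  χ-injective : ∀ {u w} → (∀ i → χ u i ≡ χ w i) → u ≡ w
  χ-injective {s , p} {t , q} χu≗χw with s≡t
    where
    s≡t : s ≡ t
    s≡t = trans (sym (tabulate∘lookup s)) (trans (tabulate-cong χu≗χw) (tabulate∘lookup t))
  ... | refl = cong (s ,_) (≡-irrelevant p q)

  fromχ : (f : Fin n → Bool) → sum (𝟙 ∘ f) ≡ m → Vertex
  fromχ f size-f =
    tabulate f , trans (card-sum (tabulate f)) (trans (sum-cong-≗ (cong 𝟙 ∘ lookup∘tabulate f)) size-f)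

  χ-fromχ : ∀ f size-f j → χ (fromχ f size-f) j ≡ f j
  χ-fromχ f _ = lookup∘tabulate f

  adjacent⇒∧≡false : ∀ {u v} → E G u v → ∀ i → χ u i ∧ χ v i ≡ false
  adjacent⇒∧≡false = Disjoint⇒∧≡false

  meet : Vertex → Vertex → ℕ
  meet u w = common (χ u) (χ w)

  meet-fromχ : ∀ x f size-f → meet x (fromχ f size-f) ≡ common (χ x) f
  meet-fromχ x f size-f = sum-cong-≗ (λ j → cong (λ b → 𝟙 (χ x j ∧ b)) (χ-fromχ f size-f j))

  meet-≤ : ∀ u w → meet u w ≤ m
  meet-≤ u w = ≤-trans (sum-mono-≤ (λ i → 𝟙-∧-≤ˡ (χ u i) (χ w i))) (≤-reflexive (χ-size u))

  meet-self : ∀ u → meet u u ≡ m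
  meet-self u = trans (sum-cong-≗ (cong 𝟙 ∘ ∧-idem ∘ χ u)) (χ-size u)

  meet-≥⇒≡ : ∀ {u w} → m ≤ meet u w → u ≡ w
  meet-≥⇒≡ {u} {w} m≤meet = χ-injective (λ i → ∧-both (χ u i) (χ w i) (u-tight i) (w-tight i))
    where
    ∧-both : ∀ a b → 𝟙 (a ∧ b) ≡ 𝟙 a → 𝟙 (a ∧ b) ≡ 𝟙 b → a ≡ b
    ∧-both true  true  _ _ = refl
    ∧-both false false _ _ = refl
    u-tight : ∀ i → 𝟙 (χ u i ∧ χ w i) ≡ 𝟙 (χ u i)
    u-tight = sum-mono-≤-tight (λ i → 𝟙-∧-≤ˡ (χ u i) (χ w i)) (≤-trans (≤-reflexive (χ-size u)) m≤meet)
    w-tight : ∀ i → 𝟙 (χ u i ∧ χ w i) ≡ 𝟙 (χ w i)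
    w-tight = sum-mono-≤-tight (λ i → 𝟙-∧-≤ʳ (χ u i) (χ w i)) (≤-trans (≤-reflexive (χ-size w)) m≤meet)

  -- Two disjoint m-sets cover all but one point of the (2m+1)-set, so they meet w in m or m-1 points.
  adjacent-meet-≤ : ∀ {u v} w → E G u v → meet u w + meet v w ≤ m
  adjacent-meet-≤ {u} {v} w u~v = begin
    meet u w + meet v w
      ≡⟨ sym (∑-distrib-+ (λ i → 𝟙 (χ u i ∧ χ w i)) (λ i → 𝟙 (χ v i ∧ χ w i))) ⟩
    sum (λ i → 𝟙 (χ u i ∧ χ w i) + 𝟙 (χ v i ∧ χ w i))
      ≤⟨ sum-mono-≤ (λ i → pointwise (χ u i) (χ v i) (χ w i) (adjacent⇒∧≡false {u} {v} u~v i)) ⟩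
    sum (𝟙 ∘ χ w)
      ≡⟨ χ-size w ⟩
    m ∎
    where
    open ≤-Reasoning
    pointwise : ∀ a b c → a ∧ b ≡ false → 𝟙 (a ∧ c) + 𝟙 (b ∧ c) ≤ 𝟙 c
    pointwise true  true  _     ()
    pointwise true  false true  _ = ≤-refl
    pointwise false true  true  _ = ≤-refl
    pointwise false false true  _ = z≤n
    pointwise a     b     false _ = ≤-reflexive (cong₂ _+_ (cong 𝟙 (∧-zeroʳ a)) (cong 𝟙 (∧-zeroʳ b)))

  adjacent-meet-≥ : ∀ {u v} w → E G u v → m ≤ suc (meet u w + meet v w)
  adjacent-meet-≥ {u} {v} w u~v = +-cancelʳ-≤ (m + m) m _ (begin
    m + (m + m)
      ≡⟨ sym (cong₂ _+_ (χ-size w) (cong₂ _+_ (χ-size u) (χ-size v))) ⟩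
    sum (𝟙 ∘ χ w) + (sum (𝟙 ∘ χ u) + sum (𝟙 ∘ χ v))
      ≡⟨ cong (sum (𝟙 ∘ χ w) +_) (∑-distrib-+ (𝟙 ∘ χ u) (𝟙 ∘ χ v)) ⟨
    sum (𝟙 ∘ χ w) + sum (λ i → 𝟙 (χ u i) + 𝟙 (χ v i))
      ≡⟨ ∑-distrib-+ (𝟙 ∘ χ w) (λ i → 𝟙 (χ u i) + 𝟙 (χ v i)) ⟨
    sum (λ i → 𝟙 (χ w i) + (𝟙 (χ u i) + 𝟙 (χ v i)))
      ≤⟨ sum-mono-≤ (λ i → pointwise (χ u i) (χ v i) (χ w i) (adjacent⇒∧≡false {u} {v} u~v i)) ⟩
    sum (λ i → (𝟙 (χ u i ∧ χ w i) + 𝟙 (χ v i ∧ χ w i)) + 1)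
      ≡⟨ ∑-distrib-+ (λ i → 𝟙 (χ u i ∧ χ w i) + 𝟙 (χ v i ∧ χ w i)) (λ _ → 1) ⟩
    sum (λ i → 𝟙 (χ u i ∧ χ w i) + 𝟙 (χ v i ∧ χ w i)) + sum {n} (λ _ → 1)
      ≡⟨ cong₂ _+_ (∑-distrib-+ (λ i → 𝟙 (χ u i ∧ χ w i)) (λ i → 𝟙 (χ v i ∧ χ w i))) (sum-one n) ⟩
    (meet u w + meet v w) + n
      ≡⟨ +-suc _ _ ⟩
    suc (meet u w + meet v w) + (m + m) ∎)
    where
    open ≤-Reasoning
    pointwise : ∀ a b c → a ∧ b ≡ false → 𝟙 c + (𝟙 a + 𝟙 b) ≤ (𝟙 (a ∧ c) + 𝟙 (b ∧ c)) + 1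
    pointwise true  true  _     ()
    pointwise true  false true  _ = ≤-refl
    pointwise true  false false _ = ≤-refl
    pointwise false true  true  _ = ≤-refl
    pointwise false true  false _ = ≤-refl
    pointwise false false true  _ = ≤-refl
    pointwise false false false _ = z≤n

  meetᶜ : Vertex → Vertex → ℕ
  meetᶜ u w = common (not ∘ χ u) (χ w)

  meetᶜ+meet : ∀ u w → meetᶜ u w + meet u w ≡ m
  meetᶜ+meet u w = begin
    meetᶜ u w + meet u w
      ≡⟨ sym (∑-distrib-+ (λ j → 𝟙 (not (χ u j) ∧ χ w j)) (λ j → 𝟙 (χ u j ∧ χ w j))) ⟩
    sum (λ j → 𝟙 (not (χ u j) ∧ χ w j) + 𝟙 (χ u j ∧ χ w j))
      ≡⟨ sum-cong-≗ (λ j → pointwise (χ u j) (χ w j)) ⟩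
    sum (𝟙 ∘ χ w)
      ≡⟨ χ-size w ⟩
    m ∎
    where
    open ≡-Reasoning
    pointwise : ∀ a c → 𝟙 (not a ∧ c) + 𝟙 (a ∧ c) ≡ 𝟙 c
    pointwise true  c     = refl
    pointwise false true  = refl
    pointwise false false = refl

  complement-size : ∀ u → sum (𝟙 ∘ not ∘ χ u) ≡ suc m
  complement-size u = +-cancelʳ-≡ m _ _ (begin
    sum (𝟙 ∘ not ∘ χ u) + m                    ≡⟨ cong (sum (𝟙 ∘ not ∘ χ u) +_) (sym (χ-size u)) ⟩
    sum (𝟙 ∘ not ∘ χ u) + sum (𝟙 ∘ χ u)        ≡⟨ sym (∑-distrib-+ (𝟙 ∘ not ∘ χ u) (𝟙 ∘ χ u)) ⟩
    sum (λ j → 𝟙 (not (χ u j)) + 𝟙 (χ u j))   ≡⟨ sum-cong-≗ (λ j → pointwise (χ u j)) ⟩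
    sum {n} (λ _ → 1)                         ≡⟨ sum-one n ⟩
    suc m + m                                 ∎)
    where
    open ≡-Reasoning
    pointwise : ∀ a → 𝟙 (not a) + 𝟙 a ≡ 1
    pointwise true  = refl
    pointwise false = refl

  module ComplementWithout (u : Vertex) (i : Fin n) (i∉u : χ u i ≡ false) where

    χv : Fin n → Bool
    χv j = not (χ u j) ∧ not (j ≡ᵇ i)

    j≡i⇒j∉u : ∀ j → j ≡ᵇ i ≡ true → χ u j ≡ false
    j≡i⇒j∉u j j≡ᵇi with ≡ᵇ⇒≡ j i j≡ᵇi
    ... | refl = i∉u

    χv-size : sum (𝟙 ∘ χv) ≡ m
    χv-size = suc-injective (begin
      suc (sum (𝟙 ∘ χv))                                 ≡⟨ +-comm 1 _ ⟩
      sum (𝟙 ∘ χv) + 1                                   ≡⟨ cong (sum (𝟙 ∘ χv) +_) (sym (sum-select (λ _ → true) i)) ⟩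
      sum (𝟙 ∘ χv) + sum (λ j → 𝟙 (j ≡ᵇ i))             ≡⟨ sym (∑-distrib-+ (𝟙 ∘ χv) (λ j → 𝟙 (j ≡ᵇ i))) ⟩
      sum (λ j → 𝟙 (χv j) + 𝟙 (j ≡ᵇ i))                 ≡⟨ sum-cong-≗ (λ j → pointwise (χ u j) (j ≡ᵇ i) (j≡i⇒j∉u j)) ⟩
      sum (𝟙 ∘ not ∘ χ u)                                ≡⟨ complement-size u ⟩
      suc m                                              ∎)
      where
      open ≡-Reasoning
      pointwise : ∀ a e → (e ≡ true → a ≡ false) → 𝟙 (not a ∧ not e) + 𝟙 e ≡ 𝟙 (not a)
      pointwise a     true  e⇒¬a rewrite e⇒¬a refl = refl
      pointwise true  false _ = refl
      pointwise false false _ = refl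

    v : Vertex
    v = fromχ χv χv-size

    u~v : E G u v
    u~v = ∧≡false⇒Disjoint (λ j → trans (cong (χ u j ∧_) (χ-fromχ χv χv-size j)) (pointwise (χ u j) (j ≡ᵇ i)))
      where
      pointwise : ∀ a e → a ∧ (not a ∧ not e) ≡ false
      pointwise true  _ = refl
      pointwise false _ = refl

    meet-v : ∀ w → meet v w + 𝟙 (χ w i) ≡ meetᶜ u w
    meet-v w = begin
      meet v w + 𝟙 (χ w i)
        ≡⟨ cong₂ _+_ (sum-cong-≗ (λ j → cong (λ b → 𝟙 (b ∧ χ w j)) (χ-fromχ χv χv-size j))) (sym (sum-select (χ w) i)) ⟩
      sum (λ j → 𝟙 (χv j ∧ χ w j)) + sum (λ j → 𝟙 (χ w j ∧ j ≡ᵇ i))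
        ≡⟨ sym (∑-distrib-+ (λ j → 𝟙 (χv j ∧ χ w j)) (λ j → 𝟙 (χ w j ∧ j ≡ᵇ i))) ⟩
      sum (λ j → 𝟙 (χv j ∧ χ w j) + 𝟙 (χ w j ∧ j ≡ᵇ i))
        ≡⟨ sum-cong-≗ (λ j → pointwise (χ u j) (j ≡ᵇ i) (χ w j) (j≡i⇒j∉u j)) ⟩
      meetᶜ u w ∎
      where
      open ≡-Reasoning
      pointwise : ∀ a e c → (e ≡ true → a ≡ false) → 𝟙 ((not a ∧ not e) ∧ c) + 𝟙 (c ∧ e) ≡ 𝟙 (not a ∧ c)
      pointwise a     true  c     e⇒¬a rewrite e⇒¬a refl | ∧-identityʳ c = +-identityˡ (𝟙 c)
      pointwise true  false c     _ = cong 𝟙 (∧-zeroʳ c)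
      pointwise false false true  _ = refl
      pointwise false false false _ = refl

    meet-v+meet : ∀ w → (meet v w + 𝟙 (χ w i)) + meet u w ≡ m
    meet-v+meet w = trans (cong (_+ meet u w) (meet-v w)) (meetᶜ+meet u w)

  ∃-neighbour-meet-complementary : ∀ u w → ∃ λ v → E G u v × meet v w + meet u w ≡ m
  ∃-neighbour-meet-complementary u w =
    let i , pos     = sum-positive (λ j → 𝟙 (not (χ u j) ∧ not (χ w j))) outside-both-positive
        i∉u , i∉w   = 𝟙-not∧not-positive (χ u i) (χ w i) pos
        open ComplementWithout u i i∉u
    in v , u~v , trans (cong (_+ meet u w) (sym (+-identityʳ (meet v w))))
                       (subst (λ b → (meet v w + 𝟙 b) + meet u w ≡ m) i∉w (meet-v+meet w))
    where
    outside-both : ℕ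
    outside-both = sum (λ j → 𝟙 (not (χ u j) ∧ not (χ w j)))

    -- |∁u ∩ ∁w| + |w ∖ u| = |∁u| = m + 1, while |w ∖ u| ≤ m.
    outside-both-positive : 0 < outside-both
    outside-both-positive = +-cancelʳ-≤ m 1 outside-both (begin
      suc m
        ≡⟨ sym (complement-size u) ⟩
      sum (𝟙 ∘ not ∘ χ u)
        ≡⟨ sym (sum-cong-≗ (λ j → pointwise (χ u j) (χ w j))) ⟩
      sum (λ j → 𝟙 (not (χ u j) ∧ not (χ w j)) + 𝟙 (not (χ u j) ∧ χ w j))
        ≡⟨ ∑-distrib-+ (λ j → 𝟙 (not (χ u j) ∧ not (χ w j))) (λ j → 𝟙 (not (χ u j) ∧ χ w j)) ⟩
      outside-both + meetᶜ u w
        ≤⟨ +-monoʳ-≤ outside-both (m≤m+n (meetᶜ u w) (meet u w)) ⟩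
      outside-both + (meetᶜ u w + meet u w)
        ≡⟨ cong (outside-both +_) (meetᶜ+meet u w) ⟩
      outside-both + m ∎)
      where
      open ≤-Reasoning
      pointwise : ∀ a c → 𝟙 (not a ∧ not c) + 𝟙 (not a ∧ c) ≡ 𝟙 (not a)
      pointwise true  _     = refl
      pointwise false true  = refl
      pointwise false false = refl

  ∃-neighbour-meet-complementary-pred : ∀ u w → meet u w < m → ∃ λ v → E G u v × suc (meet v w + meet u w) ≡ m
  ∃-neighbour-meet-complementary-pred u w meet<m =
    let i , pos   = sum-positive (λ j → 𝟙 (not (χ u j) ∧ χ w j)) w∖u-positive
        i∉u , i∈w = 𝟙-not∧-positive (χ u i) (χ w i) pos
        open ComplementWithout u i i∉u
    in v , u~v , trans (cong (_+ meet u w) (+-comm 1 (meet v w)))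
                       (subst (λ b → (meet v w + 𝟙 b) + meet u w ≡ m) i∈w (meet-v+meet w))
    where
    w∖u-positive : 0 < meetᶜ u w
    w∖u-positive = +-cancelʳ-≤ (meet u w) 1 _ (≤-trans meet<m (≤-reflexive (sym (meetᶜ+meet u w))))

  mutual
    even-walk⇒ : ∀ h {u w} → Walk G u w (h + h) → m ≤ meet u w + h
    even-walk⇒ zero    {u} nil = ≤-reflexive (sym (trans (+-identityʳ _) (meet-self u)))
    even-walk⇒ (suc h) {u} {w} (cons {y = v} u~v walk) = begin
      m                        ≤⟨ adjacent-meet-≥ {u} {v} w u~v ⟩
      suc (meet u w + meet v w) ≤⟨ s≤s (+-monoʳ-≤ (meet u w) (odd-walk⇒ h (subst (Walk G v w) (+-suc h h) walk))) ⟩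
      suc (meet u w + h)        ≡⟨ sym (+-suc (meet u w) h) ⟩
      meet u w + suc h          ∎
      where open ≤-Reasoning

    odd-walk⇒ : ∀ h {u w} → Walk G u w (suc (h + h)) → meet u w ≤ h
    odd-walk⇒ h {u} {w} (cons {y = v} u~v walk) = +-cancelˡ-≤ (meet v w) _ _ (begin
      meet v w + meet u w ≡⟨ +-comm (meet v w) (meet u w) ⟩
      meet u w + meet v w ≤⟨ adjacent-meet-≤ {u} {v} w u~v ⟩
      m                   ≤⟨ even-walk⇒ h walk ⟩
      meet v w + h        ∎)
      where open ≤-Reasoning

  mutual
    even-walk⇐ : ∀ h u w → m ≤ meet u w + h → Walk G u w (h + h)
    even-walk⇐ zero    u w m≤meet = subst (λ z → Walk G u z 0) (meet-≥⇒≡ (≤-trans m≤meet (≤-reflexive (+-identityʳ _)))) nil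
    even-walk⇐ (suc h) u w m≤meet+h with meet u w <? m
    ... | yes meet<m =
      let v , u~v , meets = ∃-neighbour-meet-complementary-pred u w meet<m
          meet-v≤h : meet v w ≤ h
          meet-v≤h = +-cancelʳ-≤ (meet u w) _ _ (≤-pred (begin
            suc (meet v w + meet u w) ≡⟨ meets ⟩
            m                         ≤⟨ m≤meet+h ⟩
            meet u w + suc h          ≡⟨ +-comm (meet u w) (suc h) ⟩
            suc (h + meet u w)        ∎))
      in cons u~v (subst (Walk G v w) (sym (+-suc h h)) (odd-walk⇐ h v w meet-v≤h))
      where open ≤-Reasoning
    ... | no meet≮m =
      let v , u~v , meets = ∃-neighbour-meet-complementary u w
          meet-v≤0 : meet v w ≤ 0
          meet-v≤0 = +-cancelʳ-≤ (meet u w) (meet v w) 0 (≤-trans (≤-reflexive meets) (≮⇒≥ meet≮m))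
      in cons u~v (subst (Walk G v w) (sym (+-suc h h)) (odd-walk⇐ h v w (≤-trans meet-v≤0 z≤n)))

    odd-walk⇐ : ∀ h u w → meet u w ≤ h → Walk G u w (suc (h + h))
    odd-walk⇐ h u w meet≤h =
      let v , u~v , meets = ∃-neighbour-meet-complementary u w
      in cons u~v (even-walk⇐ h v w (≤-trans (≤-reflexive (sym meets)) (+-monoʳ-≤ (meet v w) meet≤h)))

  walk? : ∀ u w ℓ → Dec (Walk G u w ℓ)
  walk? u w ℓ with half ℓ
  ... | even h = map′ (even-walk⇐ h u w) (even-walk⇒ h) (m ≤? meet u w + h)
  ... | odd  h = map′ (odd-walk⇐ h u w) (odd-walk⇒ h) (meet u w ≤? h)

  walk-transfer : ∀ {x y} w → meet x w ≡ meet y w → ∀ ℓ → Walk G x w ℓ → Walk G y w ℓ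
  walk-transfer w meets ℓ p with half ℓ
  ... | even h = even-walk⇐ h _ w (subst (λ j → m ≤ j + h) meets (even-walk⇒ h p))
  ... | odd  h = odd-walk⇐ h _ w (subst (_≤ h) meets (odd-walk⇒ h p))

  ∃-Dist-O : ∀ x w → ∃ (Dist G x w)
  ∃-Dist-O x w = ∃-Dist G (walk? x w) (odd-walk⇐ m x w (meet-≤ x w))

  ParityDist-even-meet : ∀ h {x w} → ParityDist G x w (h + h) → meet x w + h ≡ m
  ParityDist-even-meet zero    {x} {w} (p , _) = ≤-antisym (≤-trans (≤-reflexive (+-identityʳ _)) (meet-≤ x w)) (even-walk⇒ 0 p)
  ParityDist-even-meet (suc h) {x} {w} (p , unshortenable) = ≤-antisym meet+h<m (even-walk⇒ (suc h) p)
    where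
    meet+h<m : meet x w + suc h ≤ m
    meet+h<m = subst (_≤ m) (sym (+-suc (meet x w) h)) (≰⇒> (λ m≤meet+h →
      unshortenable (h + h) (even-walk⇐ h x w m≤meet+h) (cong suc (sym (+-suc h h)))))

  ParityDist-odd-meet : ∀ h {x w} → ParityDist G x w (suc (h + h)) → meet x w ≡ h
  ParityDist-odd-meet zero    (p , _) = n≤0⇒n≡0 (odd-walk⇒ 0 p)
  ParityDist-odd-meet (suc h) {x} {w} (p , unshortenable) = ≤-antisym (odd-walk⇒ (suc h) p) (≰⇒> (λ meet≤h →
    unshortenable (suc (h + h)) (odd-walk⇐ h x w meet≤h) (cong (λ k → suc (suc k)) (sym (+-suc h h)))))

  ParityDist-meet : ∀ {x y w a} → ParityDist G x w a → ParityDist G y w a → meet x w ≡ meet y w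
  ParityDist-meet {a = a} px py with half a
  ... | even h = +-cancelʳ-≡ h _ _ (trans (ParityDist-even-meet h px) (sym (ParityDist-even-meet h py)))
  ... | odd  h = trans (ParityDist-odd-meet h px) (sym (ParityDist-odd-meet h py))

  MeetResolving : List Vertex → Set
  MeetResolving R = ∀ x y → x ≢ y → ∃ λ r → r ∈ R × meet x r ≢ meet y r

  Resolving⇒MeetResolving : ∀ R → Resolving G R → MeetResolving R
  Resolving⇒MeetResolving R resolves x y x≢y with w , w∈R , distinguishes ← resolves x y x≢y =
    w , w∈R , λ meets →
      let a , dist = ∃-Dist-O x w
      in distinguishes a a dist (Dist-transfer G (walk-transfer w meets) (walk-transfer w (sym meets)) dist) refl

  MeetResolving⇒Resolving : ∀ R → MeetResolving R → Resolving G R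
  MeetResolving⇒Resolving R resolves x y x≢y with r , r∈R , meets≢ ← resolves x y x≢y =
    r , r∈R , λ { a _ dx dy refl → meets≢ (ParityDist-meet (Dist⇒ParityDist G dx) (Dist⇒ParityDist G dy)) }

  D : Graph
  D = BipartiteDouble G

  Resolving-double⇒MeetResolving : ∀ R → Resolving D R → MeetResolving (map proj₂ R)
  Resolving-double⇒MeetResolving R resolves x y x≢y
    with (c , r) , cr∈R , distinguishes ← resolves (true , x) (true , y) (x≢y ∘ cong proj₂) =
    r , ∈-map⁺ proj₂ cr∈R , λ meets →
      let a , dist = ∃-Dist-double (walk? x r) (even-walk⇐ m x r (m≤n+m m _)) (odd-walk⇐ m x r (meet-≤ x r)) true c
      in distinguishes a a dist
           (Dist-transfer D (walk-transfer-double (walk-transfer r meets))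
                            (walk-transfer-double (walk-transfer r (sym meets))) dist)
           refl

  MeetResolving⇒Resolving-double : ∀ R → MeetResolving (map proj₂ R) → ∃ (_∈ R) → Resolving D R
  MeetResolving⇒Resolving-double R resolves (w , w∈R) (b , x) (c , y) bx≢cy with b ≟ᵇ c
  ... | no b≢c = w , w∈R , opposite-sides-distinguished x y w b≢c
  ... | yes refl
    with r , r∈R , meets≢ ← resolves x y (bx≢cy ∘ cong (b ,_))
    with (c′ , _) , c′r∈R , refl ← ∈-map⁻ proj₂ r∈R =
    (c′ , r) , c′r∈R ,
    λ { a _ dx dy refl → meets≢ (ParityDist-meet (Dist⇒ParityDist-double dx) (Dist⇒ParityDist-double dy)) }

  vertex-searchable : Searchable Vertex
  vertex-searchable = Σ-searchable anySubset? (λ s → ∣ s ∣ ≟ m) ≡-irrelevant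

  _≟ᵛ_ : (x y : Vertex) → Dec (x ≡ y)
  (s , p) ≟ᵛ (t , q) = map′ (λ { refl → cong (s ,_) (≡-irrelevant p q) }) (cong proj₁) (≡-dec _≟ᵇ_ s t)

  separates? : ∀ R x y → Dec (∃ λ r → r ∈ R × meet x r ≢ meet y r)
  separates? R x y = map′ find (λ (r , r∈R , p) → lose r∈R p) (any? (λ r → ¬? (meet x r ≟ meet y r)) R)

  meetResolving? : ∀ R → Dec (MeetResolving R)
  meetResolving? R =
    searchable⇒all? vertex-searchable λ x → searchable⇒all? vertex-searchable λ y → ¬? (x ≟ᵛ y) →-dec separates? R x y

  meets-injective⇒MeetResolving : ∀ R → (∀ x y → (∀ r → r ∈ R → meet x r ≡ meet y r) → x ≡ y) → MeetResolving R
  meets-injective⇒MeetResolving R injective x y x≢y with separates? R x y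
  ... | yes separated = separated
  ... | no ¬separated = ⊥-elim (x≢y (injective x y λ r r∈R →
                          decidable-stable (meet x r ≟ meet y r) (λ meets≢ → ¬separated (r , r∈R , meets≢))))

  metric-dimensions : ∀ {x₀ y₀} → x₀ ≢ y₀ → ∀ R₀ → MeetResolving R₀ →
                      ∃ λ d → MetricDimension G d × MetricDimension D d × d ≤ length R₀
  metric-dimensions {x₀} {y₀} x₀≢y₀ R₀ resolves₀
    with d , (R , len , resolves) , minimal , d≤ ← least-length vertex-searchable meetResolving? R₀ resolves₀ =
    d , ((R , len , MeetResolving⇒Resolving R resolves) , λ R′ → minimal R′ ∘ Resolving⇒MeetResolving R′)
      , ((tagged , trans (length-map _ R) len , MeetResolving⇒Resolving-double tagged tagged-resolves tagged-nonempty)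
        , λ R′ → subst (d ≤_) (length-map proj₂ R′) ∘ minimal _ ∘ Resolving-double⇒MeetResolving R′)
      , d≤
    where
    tagged : List (V D)
    tagged = map (true ,_) R
    tagged-resolves : MeetResolving (map proj₂ tagged)
    tagged-resolves = subst MeetResolving (sym (trans (sym (map-∘ R)) (map-id R))) resolves
    tagged-nonempty : ∃ (_∈ tagged)
    tagged-nonempty with r , r∈R , _ ← resolves x₀ y₀ x₀≢y₀ = (true , r) , ∈-map⁺ (true ,_) r∈R

-- A resolving set of size 2k - 2

module ResolvingSet (m′ : ℕ) where

  m : ℕ
  m = suc m′

  open OddGraph m

  inA outA : Fin m → Fin n
  inA  i = suc (i ↑ˡ m)
  outA i = suc (m ↑ʳ i)

  Aχ : Fin n → Bool
  Aχ = false ∷ᶠ (replicate m true ++ᶠ replicate m false)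

  Aχ-inA : ∀ i → Aχ (inA i) ≡ true
  Aχ-inA = lookup-++ˡ (replicate m true) (replicate m false)

  Aχ-outA : ∀ i → Aχ (outA i) ≡ false
  Aχ-outA = lookup-++ʳ (replicate m true) (replicate m false)

  sum-by-position : ∀ (g : Fin n → ℕ) → sum g ≡ g zero + (sum (g ∘ inA) + sum (g ∘ outA))
  sum-by-position g = cong (g zero +_) (sum-↑ m m (g ∘ suc))

  Aχ-size : sum (𝟙 ∘ Aχ) ≡ m
  Aχ-size = begin
    sum (𝟙 ∘ Aχ)
      ≡⟨ sum-by-position (𝟙 ∘ Aχ) ⟩
    0 + (sum (𝟙 ∘ Aχ ∘ inA) + sum (𝟙 ∘ Aχ ∘ outA))
      ≡⟨ cong₂ _+_ (trans (sum-cong-≗ (cong 𝟙 ∘ Aχ-inA)) (sum-one m))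
                   (trans (sum-cong-≗ (cong 𝟙 ∘ Aχ-outA)) (sum-zero m)) ⟩
    m + 0
      ≡⟨ +-identityʳ m ⟩
    m ∎
    where open ≡-Reasoning

  A : Vertex
  A = fromχ Aχ Aχ-size

  swapχ : Fin m → Fin m → Fin n → Bool
  swapχ l t = swap Aχ (inA l) (outA t)

  swapχ-size : ∀ l t → sum (𝟙 ∘ swapχ l t) ≡ m
  swapχ-size l t = trans (swap-size Aχ {inA l} {outA t} (Aχ-inA l) (Aχ-outA t)) Aχ-size

  swapped : Fin m → Fin m → Vertex
  swapped l t = fromχ (swapχ l t) (swapχ-size l t)

  -- A and its 2m - 1 one-point exchanges: inA 0 for each outA t, and each other inA l for outA 0.
  Q : List Vertex
  Q = A ∷ List.tabulate (swapped zero) List.++ List.tabulate (λ l → swapped (suc l) zero)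

  length-Q : length Q ≡ m + m
  length-Q = cong suc (begin
    length (List.tabulate (swapped zero) List.++ List.tabulate (λ l → swapped (suc l) zero))
      ≡⟨ length-++ (List.tabulate (swapped zero)) ⟩
    length (List.tabulate (swapped zero)) + length (List.tabulate (λ l → swapped (suc l) zero))
      ≡⟨ cong₂ _+_ (length-tabulate (swapped zero)) (length-tabulate (λ l → swapped (suc l) zero)) ⟩
    m + m′
      ≡⟨ sym (+-suc m′ m′) ⟩
    m′ + m ∎)
    where open ≡-Reasoning

  A≢swapped : A ≢ swapped zero zero
  A≢swapped A≡swapped = case at-inA0 of λ ()
    where
    open ≡-Reasoning
    at-inA0 : Aχ (inA zero) ≡ swapχ zero zero (inA zero)
    at-inA0 = begin
      Aχ (inA zero)                    ≡⟨ χ-fromχ Aχ Aχ-size (inA zero) ⟨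
      χ A (inA zero)                   ≡⟨ cong (λ z → χ z (inA zero)) A≡swapped ⟩
      χ (swapped zero zero) (inA zero) ≡⟨ χ-fromχ (swapχ zero zero) (swapχ-size zero zero) (inA zero) ⟩
      swapχ zero zero (inA zero)       ∎

  module SameMeets {x y} (same : ∀ q → q ∈ Q → meet x q ≡ meet y q) where

    balance : ∀ l t → swapped l t ∈ Q → 𝟙 (χ x (outA t)) + 𝟙 (χ y (inA l)) ≡ 𝟙 (χ y (outA t)) + 𝟙 (χ x (inA l))
    balance l t mem = swap-balance Aχ {inA l} {outA t} (Aχ-inA l) (Aχ-outA t) (χ x) (χ y)
      (trans (sym (meet-fromχ x Aχ Aχ-size)) (trans (same A (here refl)) (meet-fromχ y Aχ Aχ-size)))
      (trans (sym (meet-fromχ x (swapχ l t) (swapχ-size l t)))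
             (trans (same (swapped l t) mem) (meet-fromχ y (swapχ l t) (swapχ-size l t))))

    balance-outA : ∀ t → 𝟙 (χ x (outA t)) + 𝟙 (χ y (inA zero)) ≡ 𝟙 (χ y (outA t)) + 𝟙 (χ x (inA zero))
    balance-outA t = balance zero t (there (∈-++⁺ˡ (∈-tabulate⁺ {f = swapped zero} t)))

    balance-inA : ∀ l → 𝟙 (χ x (outA zero)) + 𝟙 (χ y (inA (suc l))) ≡ 𝟙 (χ y (outA zero)) + 𝟙 (χ x (inA (suc l)))
    balance-inA l =
      balance (suc l) zero (there (∈-++⁺ʳ (List.tabulate (swapped zero)) (∈-tabulate⁺ {f = λ l → swapped (suc l) zero} l)))

    agree : χ x (inA zero) ≡ χ y (inA zero) → x ≡ y
    agree agree-inA0 = χ-injective agree-everywhere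
      where
      agree-outA : ∀ t → χ x (outA t) ≡ χ y (outA t)
      agree-outA t = 𝟙-injective (+-cancelʳ-≡ _ _ _
        (subst (λ b → 𝟙 (χ x (outA t)) + 𝟙 b ≡ 𝟙 (χ y (outA t)) + 𝟙 (χ x (inA zero))) (sym agree-inA0) (balance-outA t)))
      agree-inA : ∀ l → χ x (inA l) ≡ χ y (inA l)
      agree-inA zero    = agree-inA0
      agree-inA (suc l) = sym (𝟙-injective (+-cancelˡ-≡ _ _ _
        (subst (λ b → 𝟙 b + 𝟙 (χ y (inA (suc l))) ≡ 𝟙 (χ y (outA zero)) + 𝟙 (χ x (inA (suc l))))
               (agree-outA zero) (balance-inA l))))
      agree-suc : ∀ j → χ x (suc j) ≡ χ y (suc j)
      agree-suc j with ↑-view m j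
      ... | inj₁ (l , refl) = agree-inA l
      ... | inj₂ (t , refl) = agree-outA t
      agree-everywhere : ∀ j → χ x j ≡ χ y j
      -- Position 0 is then determined by |x| = |y| = m.
      agree-everywhere zero    = 𝟙-injective (+-cancelʳ-≡ _ _ _
        (trans (χ-size x) (trans (sym (χ-size y)) (cong (𝟙 (χ y zero) +_) (sum-cong-≗ (cong 𝟙 ∘ sym ∘ agree-suc))))))
      agree-everywhere (suc j) = agree-suc j

    -- The balances force every outA t into x, which already contains inA 0: m + 1 points in an m-set.
    disagree : χ x (inA zero) ≡ true → χ y (inA zero) ≡ false → ⊥
    disagree inA0∈x inA0∉y = 1+n≰n (begin
      suc m
        ≡⟨ cong suc (sym (trans (sum-cong-≗ (cong 𝟙 ∘ outA∈x)) (sum-one m))) ⟩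
      𝟙 true + sum (𝟙 ∘ χ x ∘ outA)
        ≡⟨ cong (λ b → 𝟙 b + sum (𝟙 ∘ χ x ∘ outA)) (sym inA0∈x) ⟩
      𝟙 (χ x (inA zero)) + sum (𝟙 ∘ χ x ∘ outA)
        ≤⟨ +-monoˡ-≤ (sum (𝟙 ∘ χ x ∘ outA)) (m≤m+n (𝟙 (χ x (inA zero))) (sum {m′} (𝟙 ∘ χ x ∘ inA ∘ suc))) ⟩
      sum (𝟙 ∘ χ x ∘ inA) + sum (𝟙 ∘ χ x ∘ outA)
        ≤⟨ m≤n+m _ (𝟙 (χ x zero)) ⟩
      𝟙 (χ x zero) + (sum (𝟙 ∘ χ x ∘ inA) + sum (𝟙 ∘ χ x ∘ outA))
        ≡⟨ sym (sum-by-position (𝟙 ∘ χ x)) ⟩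
      sum (𝟙 ∘ χ x)
        ≡⟨ χ-size x ⟩
      m ∎)
      where
      open ≤-Reasoning
      outA∈x : ∀ t → χ x (outA t) ≡ true
      outA∈x t = forced (χ x (outA t)) (χ y (outA t))
        (subst₂ (λ b c → 𝟙 (χ x (outA t)) + 𝟙 b ≡ 𝟙 (χ y (outA t)) + 𝟙 c) inA0∉y inA0∈x (balance-outA t))
        where
        forced : ∀ a b → 𝟙 a + 0 ≡ 𝟙 b + 1 → a ≡ true
        forced true _ _ = refl
        forced false false ()
        forced false true ()

  Q-meets-injective : ∀ x y → (∀ q → q ∈ Q → meet x q ≡ meet y q) → x ≡ y
  Q-meets-injective x y same = by-cases (χ x (inA zero)) (χ y (inA zero)) refl refl
    where
    by-cases : ∀ a b → χ x (inA zero) ≡ a → χ y (inA zero) ≡ b → x ≡ y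
    by-cases true  true  x₀ y₀ = SameMeets.agree {x} {y} same (trans x₀ (sym y₀))
    by-cases false false x₀ y₀ = SameMeets.agree {x} {y} same (trans x₀ (sym y₀))
    by-cases true  false x₀ y₀ = ⊥-elim (SameMeets.disagree {x} {y} same x₀ y₀)
    by-cases false true  x₀ y₀ = ⊥-elim (SameMeets.disagree {y} {x} (λ q q∈Q → sym (same q q∈Q)) y₀ x₀)

  Q-resolving : MeetResolving Q
  Q-resolving = meets-injective⇒MeetResolving Q Q-meets-injective

  metric-dimensions-≤ : ∃ λ d → MetricDimension G d × MetricDimension D d × d ≤ m + m
  metric-dimensions-≤ =
    let d , dim-G , dim-D , d≤ = metric-dimensions A≢swapped Q Q-resolving
    in d , dim-G , dim-D , subst (d ≤_) length-Q d≤

2*[1+m]∸1≡1+m+m : ∀ m → 2 * suc m ∸ 1 ≡ suc (m + m)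
2*[1+m]∸1≡1+m+m m = trans (+-suc m (m + 0)) (cong (λ z → suc (m + z)) (+-identityʳ m))

corollary2p10 : (k : ℕ) → 2 ≤ k →
    ∃ λ d → MetricDimension (Odd k) d × MetricDimension (DoubledOdd k) d × d ≤ 2 * k ∸ 2
-- (2k ∸ 1) ∸ 1 reduces to 2k ∸ 2, so only the size of the ground set has to be rewritten.
corollary2p10 (suc (suc m′)) (s≤s (s≤s z≤n)) =
  subst Claim (sym (2*[1+m]∸1≡1+m+m (suc m′))) (ResolvingSet.metric-dimensions-≤ m′)
  where
  Claim : ℕ → Set
  Claim N = ∃ λ d → MetricDimension (Kneser N (suc m′)) d
                  × MetricDimension (BipartiteDouble (Kneser N (suc m′))) d
                  × d ≤ N ∸ 1
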